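{- Let $n\equiv3\pmod 4$, let $Z_n<\mathfrak S_n$ be the cyclic group generated by $(1\,2\,\cdots\,n)$ and $D_n<\mathfrak S_n$ the dihedral group of symmetries of the regular $n$-gon with vertices labelled $1,\dots,n$ cyclically. Then $|\Theta^{\mathfrak S_n}_{Z_n}|=2\,|\Theta^{\mathfrak S_n}_{D_n}|$.
   Context: For a subgroup $H$ of a group $G$, the inverse of the double coset $HgH$ is $Hg^{ -1}H$; $\Theta^G_H$ is the set of double cosets in $H\backslash G/H$ equal to their inverse. -}

module Defs where

open import Data.Nat using (ℕ; _+_; _*_; _∸_; _%_; NonZero)
open import Data.Fin using (Fin; toℕ)
open import Data.Fin.Permutation using (Permutation′; _⟨$⟩ʳ_; _⟨$⟩ˡ_)
open import Data.Product using (Σ; _×_)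
open import Data.Sum using (_⊎_)
open import Relation.Binary.PropositionalEquality using (_≡_)

-- Elements of the symmetric group on the labels 0,…,n-1 (label j+1 of the paper ↦ j).
Perm : ℕ → Set
Perm n = Permutation′ n

Subgroup : ℕ → Set₁
Subgroup n = Perm n → Set

InZ : (n : ℕ) → .{{NonZero n}} → Subgroup n
InZ n g = Σ ℕ λ k → ∀ i → toℕ (g ⟨$⟩ʳ i) ≡ (toℕ i + k) % n

InD : (n : ℕ) → .{{NonZero n}} → Subgroup n
InD n g = Σ ℕ λ k →
  (∀ i → toℕ (g ⟨$⟩ʳ i) ≡ (toℕ i + k) % n)
  ⊎ (∀ i → toℕ (g ⟨$⟩ʳ i) ≡ (k + n ∸ toℕ i) % n)

InDC : ∀ {n} → Subgroup n → Perm n → Perm n → Set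
InDC {n} H g g' = Σ (Perm n) λ h₁ → Σ (Perm n) λ h₂ →
  H h₁ × H h₂ × (∀ i → g' ⟨$⟩ʳ i ≡ h₁ ⟨$⟩ʳ (g ⟨$⟩ʳ (h₂ ⟨$⟩ʳ i)))

-- Inverse of the permutation g (as a function i ↦ g⁻¹ i).
-- HgH equals its inverse Hg⁻¹H  iff  g⁻¹ ∈ HgH.
SelfInverseDC : ∀ {n} → Subgroup n → Perm n → Set
SelfInverseDC {n} H g = Σ (Perm n) λ h₁ → Σ (Perm n) λ h₂ →
  H h₁ × H h₂ × (∀ i → g ⟨$⟩ˡ i ≡ h₁ ⟨$⟩ʳ (g ⟨$⟩ʳ (h₂ ⟨$⟩ʳ i)))

-- |Θ^{S_n}_H| = k : there are representatives r 0,…,r (k-1) of pairwise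
-- distinct double cosets, each self-inverse, and every self-inverse
-- double coset is one of them.
ThetaCard : ∀ {n} → Subgroup n → ℕ → Set
ThetaCard {n} H k = Σ (Fin k → Perm n) λ r →
  (∀ i → SelfInverseDC H (r i))
  × (∀ i j → InDC H (r i) (r j) → i ≡ j)
  × (∀ g → SelfInverseDC H g → Σ (Fin k) λ i → InDC H (r i) g)

-- The rotation subgroup Z of the dihedral group D has index two, D = Z ∪ σZ for the reflection
-- σ : i ↦ -i, and σ normalises Z. Hence every double coset DgD is the union of the four
-- Z-double cosets of g, σg, gσ and σgσ. For odd n a reflection has exactly one fixed point,
-- whereas a non-trivial conjugate of a rotation has none; so σg ∉ ZgZ. For n ≡ 3 (mod 4) no
-- reflection is a square, because x² = τ forces x to permute the n - 1 points moved by τ in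
-- orbits of length four; so σg ∉ Zg⁻¹Z. A short case analysis with these two facts shows that
-- every self-inverse D-double coset contains exactly two self-inverse Z-double cosets.
module Submission where

open import Level using (Level; _⊔_; 0ℓ)
open import Algebra.Bundles using (Group)
open import Data.Empty using (⊥-elim)
open import Data.Fin.Base
  using (Fin; zero; suc; toℕ; fromℕ<; punchIn; punchOut; combine; remQuot; splitAt; _↑ˡ_; _↑ʳ_)
open import Data.Fin.Properties
  using ( _≟_; all?; any?; toℕ-injective; toℕ<n; toℕ-fromℕ<; splitAt-↑ˡ; splitAt-↑ʳ
        ; remQuot-combine; combine-remQuot)
import Data.Fin.Permutation as Permutation
open Permutation using (Permutation; Permutation′; _⟨$⟩ʳ_; _⟨$⟩ˡ_; permutation; insert; insert-remove)
  renaming (_≈_ to _≈ₚ_)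
open import Data.List.Base
  using (List; []; _∷_; length; lookup; filter; deduplicate; allFin; cartesianProductWith)
open import Data.List.Properties using (filter-all; length-tabulate)
open import Data.List.Membership.Propositional using (_∈_)
open import Data.List.Membership.Propositional.Properties
  using (∈-lookup; ∈-allFin; ∈-filter⁺; ∈-filter⁻)
open import Data.List.Membership.Setoid.Properties using () renaming (∈-filter⁺ to ∈ₛ-filter⁺)
open import Data.List.Relation.Unary.All as All using ()
open import Data.List.Relation.Unary.All.Properties using (all-filter)
open import Data.List.Relation.Unary.Any as Any using (Any; here; there; index)
open import Data.List.Relation.Unary.Any.Properties using (lookup-index; cartesianProductWith⁺)
open import Data.List.Relation.Unary.AllPairs using (_∷_)
open import Data.List.Relation.Unary.Enumerates.Setoid using (IsEnumeration)
open import Data.List.Relation.Unary.Enumerates.Setoid.Properties using (deduplicate⁺)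
open import Data.List.Relation.Unary.Unique.DecSetoid.Properties using (deduplicate-!)
open import Data.List.Relation.Unary.Unique.Setoid using () renaming (Unique to Uniqueₛ)
open import Data.List.Relation.Unary.Unique.Setoid.Properties
  using () renaming (filter⁺ to Uniqueₛ-filter⁺)
open import Data.List.Relation.Unary.Unique.Propositional using (Unique)
open import Data.List.Relation.Unary.Unique.Propositional.Properties
  using (allFin⁺) renaming (filter⁺ to Unique-filter⁺)
open import Data.Nat.Base using (ℕ; zero; suc; _+_; _*_; _∸_; _%_; _<_; _≤_; NonZero; s≤s; z≤n)
open import Data.Nat.Divisibility using (_∣_; divides; ∣-refl; ∣m∣n⇒∣m+n; ∣m+n∣m⇒∣n; m∣m*n; ∣⇒≤)
open import Data.Nat.DivMod
  using ( _mod_; m%n%n≡m%n; [m+n]%n≡m%n; [m+kn]%n≡m%n; %-distribˡ-+; %-distribˡ-*; m%n≤n; m%n<n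
        ; m<n⇒m%n≡m)
open import Data.Nat.Induction using (<-wellFounded)
open import Data.Nat.Properties
  using ( +-commutativeSemigroup; +-identityʳ; +-assoc; +-comm; *-distribʳ-+; m∸n+n≡m; <⇒≤; <-trans
        ; ≤-trans; m≤n+m)
open import Algebra.Properties.CommutativeSemigroup +-commutativeSemigroup using (xy∙z≈xz∙y; xy∙z≈zx∙y)
open import Data.Nat.Tactic.RingSolver using (solve-∀)
open import Data.Product.Base using (Σ; _×_; _,_; proj₁; proj₂; uncurry)
open import Data.Sum.Base using (_⊎_; inj₁; inj₂; [_,_]′)
open import Function.Base using (_∘_)
open import Function.Bundles using (Injection)
open import Function.Properties.Inverse using (↔⇒↣)
open import Induction.WellFounded using (Acc; acc)
open import Relation.Binary.Bundles using (Setoid; DecSetoid)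
open import Relation.Binary.Core using (Rel; _⇒_)
import Relation.Binary.Construct.On as On
open import Relation.Binary.Definitions
  using (Symmetric; _Respects_; DecidableEquality) renaming (Decidable to Decidable₂)
open import Relation.Binary.PropositionalEquality as ≡
  using (_≡_; _≢_; refl; cong; subst; module ≡-Reasoning)
open import Relation.Binary.Structures using (IsEquivalence)
open import Relation.Nullary.Decidable using (yes; no; ¬?; map′)
open import Relation.Nullary.Negation using (¬_)
open import Relation.Unary using (Pred; Decidable)
open import Tactic.MonoidSolver using (solve)
open import Defs

private
  variable
    a ℓ ℓ′ : Level
    A : Set a

-- ThetaCard H k unfolds to Transversal (InDC H) (SelfInverseDC H) k.
Transversal : Rel A ℓ → Pred A ℓ′ → ℕ → Set _
Transversal {A = A} _∼_ P k = Σ (Fin k → A) λ r →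
  (∀ i → P (r i)) × (∀ i j → r i ∼ r j → i ≡ j) × (∀ g → P g → Σ (Fin k) λ i → r i ∼ g)

module _ {_∼_ : Rel A ℓ} {P : Pred A ℓ′} (∼-sym : Symmetric _∼_) where

  transversal-pair : ∀ {x y} → P x → P y → ¬ x ∼ y → (∀ g → P g → x ∼ g ⊎ y ∼ g) →
                     Transversal _∼_ P 2
  transversal-pair {x} {y} Px Py x≁y cover = r , r-P , distinct , r-cover
    where
    r : Fin 2 → A
    r zero    = x
    r (suc _) = y
    r-P : ∀ i → P (r i)
    r-P zero    = Px
    r-P (suc _) = Py
    distinct : ∀ i j → r i ∼ r j → i ≡ j
    distinct zero       zero       _   = refl
    distinct zero       (suc zero) x∼y = ⊥-elim (x≁y x∼y)
    distinct (suc zero) zero       y∼x = ⊥-elim (x≁y (∼-sym y∼x))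
    distinct (suc zero) (suc zero) _   = refl
    r-cover : ∀ g → P g → Σ (Fin 2) λ i → r i ∼ g
    r-cover g Pg = [ (zero ,_) , (suc zero ,_) ]′ (cover g Pg)

module _ (S : Setoid a ℓ) where
  open Setoid S using (_≈_; sym)

  lookup-injective : ∀ {xs} → Uniqueₛ S xs → ∀ i j → lookup xs i ≈ lookup xs j → i ≡ j
  lookup-injective {_ ∷ _} _         zero    zero    _   = refl
  lookup-injective {_ ∷ _} (x≉ ∷ _) zero    (suc j) x≈  = ⊥-elim (All.lookup x≉ (∈-lookup j) x≈)
  lookup-injective {_ ∷ _} (x≉ ∷ _) (suc i) zero    ≈x  = ⊥-elim (All.lookup x≉ (∈-lookup i) (sym ≈x))
  lookup-injective {_ ∷ _} (_ ∷ u)  (suc i) (suc j) eq  = cong suc (lookup-injective u i j eq)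

module _ (S : DecSetoid a ℓ) where
  open DecSetoid S using (Carrier; _≈_; setoid; sym) renaming (_≟_ to _≈?_)

  transversal-exists : {P : Pred Carrier ℓ′} → Decidable P → P Respects _≈_ →
                       (xs : List Carrier) → IsEnumeration setoid xs → Σ ℕ (Transversal _≈_ P)
  transversal-exists {P = P} P? resp xs enum = length ys , lookup ys , lookup-P , distinct , cover
    where
    ys : List Carrier
    ys = filter P? (deduplicate _≈?_ xs)
    lookup-P : ∀ i → P (lookup ys i)
    lookup-P i = All.lookup (all-filter P? (deduplicate _≈?_ xs)) (∈-lookup i)
    distinct : ∀ i j → lookup ys i ≈ lookup ys j → i ≡ j
    distinct = lookup-injective setoid (Uniqueₛ-filter⁺ setoid P? (deduplicate-! S xs))
    cover : ∀ g → P g → Σ (Fin (length ys)) λ i → lookup ys i ≈ g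
    cover g Pg = index g∈ys , sym (lookup-index g∈ys)
      where g∈ys = ∈ₛ-filter⁺ setoid P? resp (deduplicate⁺ S enum g) Pg

module _ {_≈_ _∼_ : Rel A ℓ} {P Q : Pred A ℓ′} (≈-equiv : IsEquivalence _≈_)
         (∼⇒≈ : _∼_ ⇒ _≈_) (Q⇒P : ∀ {g} → Q g → P g) where
  open IsEquivalence ≈-equiv using (sym; trans)

  transversal-fibred : ∀ {b m} → Transversal _≈_ P b →
    (∀ {r} → P r → Transversal _∼_ (λ g → Q g × r ≈ g) m) → Transversal _∼_ Q (m * b)
  transversal-fibred {b} {m} (r , r-P , r-distinct , r-cover) fibre =
    (λ t → rep (remQuot {m} b t)) , (λ t → rep-Q (remQuot {m} b t)) , distinct , cover
    where
    rep : Fin m × Fin b → A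
    rep (c , i) = proj₁ (fibre (r-P i)) c

    rep-Q : ∀ ci → Q (rep ci)
    rep-Q (c , i) = let (_ , s-P , _ , _) = fibre (r-P i) in proj₁ (s-P c)

    r≈rep : ∀ c i → r i ≈ rep (c , i)
    r≈rep c i = let (_ , s-P , _ , _) = fibre (r-P i) in proj₂ (s-P c)

    rep-distinct : ∀ ci dj → rep ci ∼ rep dj → ci ≡ dj
    rep-distinct (c , i) (d , j) e
      with r-distinct i j (trans (r≈rep c i) (trans (∼⇒≈ e) (sym (r≈rep d j))))
    ... | refl = let (_ , _ , s-distinct , _) = fibre (r-P i) in cong (_, i) (s-distinct c d e)

    distinct : ∀ t u → rep (remQuot {m} b t) ∼ rep (remQuot {m} b u) → t ≡ u
    distinct t u e = begin
      t                                  ≡⟨ combine-remQuot {m} b t ⟨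
      uncurry combine (remQuot {m} b t)  ≡⟨ cong (uncurry combine) (rep-distinct _ _ e) ⟩
      uncurry combine (remQuot {m} b u)  ≡⟨ combine-remQuot {m} b u ⟩
      u                                  ∎
      where open ≡-Reasoning

    cover : ∀ g → Q g → Σ (Fin (m * b)) λ t → rep (remQuot {m} b t) ∼ g
    cover g Qg =
      let (i , ri≈g) = r-cover g (Q⇒P Qg)
          (_ , _ , _ , s-cover) = fibre (r-P i)
          (c , e) = s-cover g (Qg , ri≈g)
      in combine c i , subst (λ ci → rep ci ∼ g) (≡.sym (remQuot-combine {k = b} c i)) e

record IsSubgroup {c ℓ h} (G : Group c ℓ) (H : Pred (Group.Carrier G) h) : Set (c ⊔ ℓ ⊔ h) where
  open Group G
  field
    ε∈       : H ε
    ∙∈       : ∀ {x y} → H x → H y → H (x ∙ y)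
    ⁻¹∈      : ∀ {x} → H x → H (x ⁻¹)
    ∈-resp-≈ : H Respects _≈_

module DoubleCoset {c ℓ h} (G : Group c ℓ) {H : Pred (Group.Carrier G) h} (H-sub : IsSubgroup G H) where
  open Group G renaming (refl to ≈-refl)
  open IsSubgroup H-sub
  open import Algebra.Properties.Group G using (⁻¹-anti-homo-∙)
  open import Relation.Binary.Reasoning.Setoid setoid

  infix 4 _∼_
  _∼_ : Rel Carrier (c ⊔ ℓ ⊔ h)
  g ∼ g′ = Σ Carrier λ h₁ → Σ Carrier λ h₂ → H h₁ × H h₂ × g′ ≈ h₁ ∙ g ∙ h₂

  SelfInverse : Pred Carrier (c ⊔ ℓ ⊔ h)
  SelfInverse g = g ∼ g ⁻¹

  ≈⇒∼ : ∀ {g g′} → g ≈ g′ → g ∼ g′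
  ≈⇒∼ {g} {g′} g≈g′ = ε , ε , ε∈ , ε∈ , (begin
    g′         ≈⟨ g≈g′ ⟨
    g          ≈⟨ solve monoid ⟩
    ε ∙ g ∙ ε  ∎)

  ∼-sym : ∀ {g g′} → g ∼ g′ → g′ ∼ g
  ∼-sym {g} {g′} (h₁ , h₂ , H₁ , H₂ , eq) = h₁ ⁻¹ , h₂ ⁻¹ , ⁻¹∈ H₁ , ⁻¹∈ H₂ , (begin
    g                                   ≈⟨ solve monoid ⟩
    ε ∙ g ∙ ε                           ≈⟨ ∙-cong (∙-congʳ (inverseˡ h₁)) (inverseʳ h₂) ⟨
    h₁ ⁻¹ ∙ h₁ ∙ g ∙ (h₂ ∙ h₂ ⁻¹)       ≈⟨ solve monoid ⟩
    h₁ ⁻¹ ∙ (h₁ ∙ g ∙ h₂) ∙ h₂ ⁻¹       ≈⟨ ∙-congʳ (∙-congˡ eq) ⟨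
    h₁ ⁻¹ ∙ g′ ∙ h₂ ⁻¹                  ∎)

  ∼-trans : ∀ {g g′ g″} → g ∼ g′ → g′ ∼ g″ → g ∼ g″
  ∼-trans {g} {g′} {g″} (h₁ , h₂ , H₁ , H₂ , eq) (k₁ , k₂ , K₁ , K₂ , eq′) =
    k₁ ∙ h₁ , h₂ ∙ k₂ , ∙∈ K₁ H₁ , ∙∈ H₂ K₂ , (begin
    g″                         ≈⟨ eq′ ⟩
    k₁ ∙ g′ ∙ k₂               ≈⟨ ∙-congʳ (∙-congˡ eq) ⟩
    k₁ ∙ (h₁ ∙ g ∙ h₂) ∙ k₂    ≈⟨ solve monoid ⟩
    k₁ ∙ h₁ ∙ g ∙ (h₂ ∙ k₂)    ∎)

  ∼-isEquivalence : IsEquivalence _∼_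
  ∼-isEquivalence = record { refl = ≈⇒∼ ≈-refl ; sym = ∼-sym ; trans = ∼-trans }

  ∼-⁻¹ : ∀ {g g′} → g ∼ g′ → g ⁻¹ ∼ g′ ⁻¹
  ∼-⁻¹ {g} {g′} (h₁ , h₂ , H₁ , H₂ , eq) = h₂ ⁻¹ , h₁ ⁻¹ , ⁻¹∈ H₂ , ⁻¹∈ H₁ , (begin
    g′ ⁻¹                    ≈⟨ ⁻¹-cong eq ⟩
    (h₁ ∙ g ∙ h₂) ⁻¹         ≈⟨ ⁻¹-anti-homo-∙ (h₁ ∙ g) h₂ ⟩
    h₂ ⁻¹ ∙ (h₁ ∙ g) ⁻¹      ≈⟨ ∙-congˡ (⁻¹-anti-homo-∙ h₁ g) ⟩
    h₂ ⁻¹ ∙ (g ⁻¹ ∙ h₁ ⁻¹)   ≈⟨ assoc _ _ _ ⟨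
    h₂ ⁻¹ ∙ g ⁻¹ ∙ h₁ ⁻¹     ∎)

  SelfInverse-resp-∼ : SelfInverse Respects _∼_
  SelfInverse-resp-∼ g∼g′ g∼g⁻¹ = ∼-trans (∼-sym g∼g′) (∼-trans g∼g⁻¹ (∼-⁻¹ g∼g′))

  module _ (_≈?_ : Decidable₂ _≈_) {s} (hs : Fin s → Carrier)
           (hs∈ : ∀ j → H (hs j)) (hs-complete : ∀ h → H h → Σ (Fin s) λ j → h ≈ hs j) where

    infix 4 _∼?_
    _∼?_ : Decidable₂ _∼_
    g ∼? g′ = map′ from to (any? λ j₁ → any? λ j₂ → g′ ≈? (hs j₁ ∙ g ∙ hs j₂))
      where
      from : (Σ (Fin s) λ j₁ → Σ (Fin s) λ j₂ → g′ ≈ hs j₁ ∙ g ∙ hs j₂) → g ∼ g′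
      from (j₁ , j₂ , eq) = hs j₁ , hs j₂ , hs∈ j₁ , hs∈ j₂ , eq
      to : g ∼ g′ → Σ (Fin s) λ j₁ → Σ (Fin s) λ j₂ → g′ ≈ hs j₁ ∙ g ∙ hs j₂
      to (h₁ , h₂ , H₁ , H₂ , eq) =
        let (j₁ , h₁≈) = hs-complete h₁ H₁ ; (j₂ , h₂≈) = hs-complete h₂ H₂
        in j₁ , j₂ , trans eq (∙-cong (∙-congʳ h₁≈) h₂≈)

    ∼-decSetoid : DecSetoid c (c ⊔ ℓ ⊔ h)
    ∼-decSetoid = record
      { isDecEquivalence = record { isEquivalence = ∼-isEquivalence ; _≟_ = _∼?_ } }

record IsIndexTwoExtension {c ℓ h} (G : Group c ℓ) (H K : Pred (Group.Carrier G) h)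
                           (σ : Group.Carrier G) : Set (c ⊔ ℓ ⊔ h) where
  open Group G
  field
    σ∈K          : K σ
    σ²≈ε         : σ ∙ σ ≈ ε
    H⊆K          : ∀ {h} → H h → K h
    K⊆H∪σH       : ∀ {k} → K k → H k ⊎ H (σ ∙ k)
    σ-normalises : ∀ {h} → H h → H (σ ∙ h ∙ σ)

module IndexTwo {c ℓ h} (G : Group c ℓ) {H K : Pred (Group.Carrier G) h}
                (H-sub : IsSubgroup G H) (K-sub : IsSubgroup G K)
                {σ : Group.Carrier G} (extension : IsIndexTwoExtension G H K σ) where

  open Group G renaming (refl to ≈-refl)
  open IsIndexTwoExtension extension
  open IsSubgroup H-sub
  open import Algebra.Properties.Group G using (⁻¹-anti-homo-∙; inverseʳ-unique)
  open import Relation.Binary.Reasoning.Setoid setoid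
  open DoubleCoset G H-sub hiding (_∼?_; ∼-decSetoid)
  open IsSubgroup K-sub using () renaming (ε∈ to ε∈ᴷ)
  open DoubleCoset G K-sub using ()
    renaming (_∼_ to _∼ᴷ_; SelfInverse to SelfInverseᴷ; ≈⇒∼ to ≈⇒∼ᴷ)

  σ⁻¹≈σ : σ ⁻¹ ≈ σ
  σ⁻¹≈σ = sym (inverseʳ-unique σ σ σ²≈ε)

  cancel-σ² : ∀ x y → x ∙ σ ∙ σ ∙ y ≈ x ∙ y
  cancel-σ² x y = begin
    x ∙ σ ∙ σ ∙ y    ≈⟨ solve monoid ⟩
    x ∙ (σ ∙ σ) ∙ y  ≈⟨ ∙-congʳ (∙-congˡ σ²≈ε) ⟩
    x ∙ ε ∙ y        ≈⟨ solve monoid ⟩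
    x ∙ y            ∎

  σ∙-involutive : ∀ g → σ ∙ (σ ∙ g) ≈ g
  σ∙-involutive g = begin
    σ ∙ (σ ∙ g)      ≈⟨ solve monoid ⟩
    ε ∙ σ ∙ σ ∙ g    ≈⟨ cancel-σ² ε g ⟩
    ε ∙ g            ≈⟨ identityˡ g ⟩
    g                ∎

  ∙σ-involutive : ∀ g → g ∙ σ ∙ σ ≈ g
  ∙σ-involutive g = begin
    g ∙ σ ∙ σ        ≈⟨ solve monoid ⟩
    g ∙ σ ∙ σ ∙ ε    ≈⟨ cancel-σ² g ε ⟩
    g ∙ ε            ≈⟨ identityʳ g ⟩
    g                ∎

  σ∙-⁻¹ : ∀ g → (σ ∙ g) ⁻¹ ≈ g ⁻¹ ∙ σ
  σ∙-⁻¹ g = trans (⁻¹-anti-homo-∙ σ g) (∙-congˡ σ⁻¹≈σ)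

  ∙σ-⁻¹ : ∀ g → (g ∙ σ) ⁻¹ ≈ σ ∙ g ⁻¹
  ∙σ-⁻¹ g = trans (⁻¹-anti-homo-∙ g σ) (∙-congʳ σ⁻¹≈σ)

  σ∙-cong : ∀ {g g′} → g ∼ g′ → σ ∙ g ∼ σ ∙ g′
  σ∙-cong {g} {g′} (h₁ , h₂ , H₁ , H₂ , eq) = σ ∙ h₁ ∙ σ , h₂ , σ-normalises H₁ , H₂ , (begin
    σ ∙ g′                        ≈⟨ ∙-congˡ eq ⟩
    σ ∙ (h₁ ∙ g ∙ h₂)             ≈⟨ solve monoid ⟩
    σ ∙ h₁ ∙ (g ∙ h₂)             ≈⟨ cancel-σ² (σ ∙ h₁) (g ∙ h₂) ⟨
    σ ∙ h₁ ∙ σ ∙ σ ∙ (g ∙ h₂)     ≈⟨ solve monoid ⟩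
    σ ∙ h₁ ∙ σ ∙ (σ ∙ g) ∙ h₂     ∎)

  ∙σ-cong : ∀ {g g′} → g ∼ g′ → g ∙ σ ∼ g′ ∙ σ
  ∙σ-cong {g} {g′} (h₁ , h₂ , H₁ , H₂ , eq) = h₁ , σ ∙ h₂ ∙ σ , H₁ , σ-normalises H₂ , (begin
    g′ ∙ σ                        ≈⟨ ∙-congʳ eq ⟩
    h₁ ∙ g ∙ h₂ ∙ σ               ≈⟨ ∙-congʳ (cancel-σ² (h₁ ∙ g) h₂) ⟨
    h₁ ∙ g ∙ σ ∙ σ ∙ h₂ ∙ σ       ≈⟨ solve monoid ⟩
    h₁ ∙ (g ∙ σ) ∙ (σ ∙ h₂ ∙ σ)   ∎)

  σ∙∙σ-involutive : ∀ g → σ ∙ (σ ∙ g ∙ σ) ∙ σ ≈ g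
  σ∙∙σ-involutive g = begin
    σ ∙ (σ ∙ g ∙ σ) ∙ σ    ≈⟨ solve monoid ⟩
    σ ∙ (σ ∙ (g ∙ σ ∙ σ))  ≈⟨ σ∙-involutive _ ⟩
    g ∙ σ ∙ σ              ≈⟨ ∙σ-involutive g ⟩
    g                      ∎

  σ∙[σ∙∙σ]≈∙σ : ∀ g → σ ∙ (σ ∙ g ∙ σ) ≈ g ∙ σ
  σ∙[σ∙∙σ]≈∙σ g = begin
    σ ∙ (σ ∙ g ∙ σ)      ≈⟨ solve monoid ⟩
    σ ∙ (σ ∙ (g ∙ σ))    ≈⟨ σ∙-involutive (g ∙ σ) ⟩
    g ∙ σ                ∎

  σ∙∙σ-⁻¹ : ∀ g → (σ ∙ g ∙ σ) ⁻¹ ≈ σ ∙ g ⁻¹ ∙ σ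
  σ∙∙σ-⁻¹ g = begin
    (σ ∙ g ∙ σ) ⁻¹    ≈⟨ ∙σ-⁻¹ (σ ∙ g) ⟩
    σ ∙ (σ ∙ g) ⁻¹    ≈⟨ ∙-congˡ (σ∙-⁻¹ g) ⟩
    σ ∙ (g ⁻¹ ∙ σ)    ≈⟨ assoc σ (g ⁻¹) σ ⟨
    σ ∙ g ⁻¹ ∙ σ      ∎

  ∼⇒∼ᴷ : ∀ {g g′} → g ∼ g′ → g ∼ᴷ g′
  ∼⇒∼ᴷ (h₁ , h₂ , H₁ , H₂ , eq) = h₁ , h₂ , H⊆K H₁ , H⊆K H₂ , eq

  ∼ᴷ-σ∙ : ∀ g → g ∼ᴷ σ ∙ g
  ∼ᴷ-σ∙ g = σ , ε , σ∈K , ε∈ᴷ , sym (identityʳ (σ ∙ g))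

  ∼ᴷ-∙σ : ∀ g → g ∼ᴷ g ∙ σ
  ∼ᴷ-∙σ g = ε , σ , ε∈ᴷ , σ∈K , ∙-congʳ (sym (identityˡ g))

  ∼ᴷ-σ∙∙σ : ∀ g → g ∼ᴷ σ ∙ g ∙ σ
  ∼ᴷ-σ∙∙σ g = σ , σ , σ∈K , σ∈K , ≈-refl

  K∙-cases : ∀ {k} x → K k → x ∼ k ∙ x ⊎ σ ∙ x ∼ k ∙ x
  K∙-cases {k} x Kk with K⊆H∪σH Kk
  ... | inj₁ Hk  = inj₁ (k , ε , Hk , ε∈ , sym (identityʳ (k ∙ x)))
  ... | inj₂ Hσk = inj₂ (k ∙ σ , ε , ∈-resp-≈ σ[σ∙]σ≈∙σ (σ-normalises Hσk) , ε∈ , (begin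
    k ∙ x                  ≈⟨ cancel-σ² k x ⟨
    k ∙ σ ∙ σ ∙ x          ≈⟨ solve monoid ⟩
    k ∙ σ ∙ (σ ∙ x) ∙ ε    ∎))
    where
    σ[σ∙]σ≈∙σ : σ ∙ (σ ∙ k) ∙ σ ≈ k ∙ σ
    σ[σ∙]σ≈∙σ = ∙-congʳ (σ∙-involutive k)

  ∙K-cases : ∀ {k} x → K k → x ∼ x ∙ k ⊎ x ∙ σ ∼ x ∙ k
  ∙K-cases {k} x Kk with K⊆H∪σH Kk
  ... | inj₁ Hk  = inj₁ (ε , k , ε∈ , Hk , ∙-congʳ (sym (identityˡ x)))
  ... | inj₂ Hσk = inj₂ (ε , σ ∙ k , ε∈ , Hσk , (begin
    x ∙ k                  ≈⟨ cancel-σ² x k ⟨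
    x ∙ σ ∙ σ ∙ k          ≈⟨ solve monoid ⟩
    ε ∙ (x ∙ σ) ∙ (σ ∙ k)  ∎))

  ∼ᴷ-cases : ∀ {g g′} → g ∼ᴷ g′ → g ∼ g′ ⊎ σ ∙ g ∼ g′ ⊎ g ∙ σ ∼ g′ ⊎ σ ∙ g ∙ σ ∼ g′
  ∼ᴷ-cases {g} {g′} (k₁ , k₂ , K₁ , K₂ , eq) = merge (K∙-cases g K₁) (∙K-cases (k₁ ∙ g) K₂)
    where
    y = k₁ ∙ g
    y∙k₂∼g′ : y ∙ k₂ ∼ g′
    y∙k₂∼g′ = ≈⇒∼ (sym eq)
    merge : g ∼ y ⊎ σ ∙ g ∼ y → y ∼ y ∙ k₂ ⊎ y ∙ σ ∼ y ∙ k₂ →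
              g ∼ g′ ⊎ σ ∙ g ∼ g′ ⊎ g ∙ σ ∼ g′ ⊎ σ ∙ g ∙ σ ∼ g′
    merge (inj₁ g∼y)  (inj₁ y∼)  = inj₁ (∼-trans g∼y (∼-trans y∼ y∙k₂∼g′))
    merge (inj₂ σg∼y) (inj₁ y∼)  = inj₂ (inj₁ (∼-trans σg∼y (∼-trans y∼ y∙k₂∼g′)))
    merge (inj₁ g∼y)  (inj₂ yσ∼) = inj₂ (inj₂ (inj₁ (∼-trans (∙σ-cong g∼y) (∼-trans yσ∼ y∙k₂∼g′))))
    merge (inj₂ σg∼y) (inj₂ yσ∼) = inj₂ (inj₂ (inj₂ (∼-trans (∙σ-cong σg∼y) (∼-trans yσ∼ y∙k₂∼g′))))

  SelfInverse-σ∙∙σ : ∀ {g} → SelfInverse g → SelfInverse (σ ∙ g ∙ σ)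
  SelfInverse-σ∙∙σ {g} s = ∼-trans (∙σ-cong (σ∙-cong s)) (≈⇒∼ (sym (σ∙∙σ-⁻¹ g)))

  SelfInverse-σ∙∙σ⁻ : ∀ {g} → SelfInverse (σ ∙ g ∙ σ) → SelfInverse g
  SelfInverse-σ∙∙σ⁻ {g} s = SelfInverse-resp-∼ (≈⇒∼ (σ∙∙σ-involutive g)) (SelfInverse-σ∙∙σ s)

  σ∙∼∙σ⇒∼σ∙∙σ : ∀ {g} → σ ∙ g ∼ g ∙ σ → g ∼ σ ∙ g ∙ σ
  σ∙∼∙σ⇒∼σ∙∙σ {g} e =
    ∼-trans (≈⇒∼ (sym (σ∙-involutive g))) (∼-trans (σ∙-cong e) (≈⇒∼ (sym (assoc σ g σ))))

  ∼σ∙∙σ⇒σ∙∼∙σ : ∀ {g} → g ∼ σ ∙ g ∙ σ → σ ∙ g ∼ g ∙ σ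
  ∼σ∙∙σ⇒σ∙∼∙σ {g} e = ∼-trans (σ∙-cong e) (≈⇒∼ (σ∙[σ∙∙σ]≈∙σ g))

  SelfInverse-σ∙⇒σ∙∼∙σ : ∀ {g} → SelfInverse g → SelfInverse (σ ∙ g) → σ ∙ g ∼ g ∙ σ
  SelfInverse-σ∙⇒σ∙∼∙σ {g} s sσ = ∼-trans sσ (∼-trans (≈⇒∼ (σ∙-⁻¹ g)) (∙σ-cong (∼-sym s)))

  SelfInverse-∙σ⇒σ∙∼∙σ : ∀ {g} → SelfInverse g → SelfInverse (g ∙ σ) → σ ∙ g ∼ g ∙ σ
  SelfInverse-∙σ⇒σ∙∼∙σ {g} s sσ = ∼-sym (∼-trans sσ (∼-trans (≈⇒∼ (∙σ-⁻¹ g)) (σ∙-cong (∼-sym s))))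

  SelfInverseIn : Carrier → Pred Carrier _
  SelfInverseIn r g = SelfInverse g × r ∼ᴷ g

  module _ (Hσ-not-conjugate : ∀ h h′ g → H h → H h′ → ¬ (h ∙ σ ≈ g ∙ h′ ∙ g ⁻¹))
           (Hσ-not-square : ∀ h x → H h → ¬ (x ∙ x ≈ h ∙ σ))
           (_∼?_ : Decidable₂ _∼_) where

    g≁σ∙g : ∀ g → ¬ (g ∼ σ ∙ g)
    g≁σ∙g g (h₁ , h₂ , H₁ , H₂ , eq) = Hσ-not-conjugate (h₁ ⁻¹) h₂ g (⁻¹∈ H₁) H₂ (begin
      h₁ ⁻¹ ∙ σ                         ≈⟨ solve monoid ⟩
      h₁ ⁻¹ ∙ σ ∙ ε                     ≈⟨ ∙-congˡ (inverseʳ g) ⟨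
      h₁ ⁻¹ ∙ σ ∙ (g ∙ g ⁻¹)            ≈⟨ solve monoid ⟩
      h₁ ⁻¹ ∙ (σ ∙ g) ∙ g ⁻¹            ≈⟨ ∙-congʳ (∙-congˡ eq) ⟩
      h₁ ⁻¹ ∙ (h₁ ∙ g ∙ h₂) ∙ g ⁻¹      ≈⟨ solve monoid ⟩
      h₁ ⁻¹ ∙ h₁ ∙ (g ∙ h₂ ∙ g ⁻¹)      ≈⟨ ∙-congʳ (inverseˡ h₁) ⟩
      ε ∙ (g ∙ h₂ ∙ g ⁻¹)               ≈⟨ identityˡ _ ⟩
      g ∙ h₂ ∙ g ⁻¹                     ∎)

    -- If g⁻¹ = h₁σgh₂ then the square of g⁻¹h₂⁻¹ is h₁σh₂⁻¹, an element of Hσ.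
    σ∙g≁g⁻¹ : ∀ g → ¬ (σ ∙ g ∼ g ⁻¹)
    σ∙g≁g⁻¹ g (h₁ , h₂ , H₁ , H₂ , eq) =
      Hσ-not-square (h₁ ∙ (σ ∙ h₂ ⁻¹ ∙ σ)) (g ⁻¹ ∙ h₂ ⁻¹) (∙∈ H₁ (σ-normalises (⁻¹∈ H₂))) (begin
      g ⁻¹ ∙ h₂ ⁻¹ ∙ (g ⁻¹ ∙ h₂ ⁻¹)                    ≈⟨ ∙-congʳ (∙-congʳ eq) ⟩
      h₁ ∙ (σ ∙ g) ∙ h₂ ∙ h₂ ⁻¹ ∙ (g ⁻¹ ∙ h₂ ⁻¹)       ≈⟨ solve monoid ⟩
      h₁ ∙ σ ∙ g ∙ (h₂ ∙ h₂ ⁻¹) ∙ (g ⁻¹ ∙ h₂ ⁻¹)       ≈⟨ ∙-congʳ (∙-congˡ (inverseʳ h₂)) ⟩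
      h₁ ∙ σ ∙ g ∙ ε ∙ (g ⁻¹ ∙ h₂ ⁻¹)                  ≈⟨ solve monoid ⟩
      h₁ ∙ σ ∙ (g ∙ g ⁻¹) ∙ h₂ ⁻¹                      ≈⟨ ∙-congʳ (∙-congˡ (inverseʳ g)) ⟩
      h₁ ∙ σ ∙ ε ∙ h₂ ⁻¹                               ≈⟨ solve monoid ⟩
      h₁ ∙ σ ∙ h₂ ⁻¹ ∙ ε                               ≈⟨ cancel-σ² (h₁ ∙ σ ∙ h₂ ⁻¹) ε ⟨
      h₁ ∙ σ ∙ h₂ ⁻¹ ∙ σ ∙ σ ∙ ε                       ≈⟨ solve monoid ⟩
      h₁ ∙ (σ ∙ h₂ ⁻¹ ∙ σ) ∙ σ                         ∎)

    SelfInverseᴷ-cases : ∀ {g} → SelfInverseᴷ g → SelfInverse g ⊎ σ ∙ g ∙ σ ∼ g ⁻¹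
    SelfInverseᴷ-cases {g} s with ∼ᴷ-cases s
    ... | inj₁ g∼g⁻¹                = inj₁ g∼g⁻¹
    ... | inj₂ (inj₁ σg∼g⁻¹)        = ⊥-elim (σ∙g≁g⁻¹ g σg∼g⁻¹)
    ... | inj₂ (inj₂ (inj₁ gσ∼g⁻¹)) =
      ⊥-elim (σ∙g≁g⁻¹ (g ⁻¹) (∼-trans (≈⇒∼ (sym (∙σ-⁻¹ g))) (∼-⁻¹ gσ∼g⁻¹)))
    ... | inj₂ (inj₂ (inj₂ σgσ∼g⁻¹)) = inj₂ σgσ∼g⁻¹

    transversal-r,σr : ∀ {r} → SelfInverse r → r ∼ σ ∙ r ∙ σ → Transversal _∼_ (SelfInverseIn r) 2
    transversal-r,σr {r} s r∼σrσ =
      transversal-pair ∼-sym (s , ≈⇒∼ᴷ ≈-refl) (sσr , ∼ᴷ-σ∙ r) (g≁σ∙g r) cover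
      where
      σr∼rσ = ∼σ∙∙σ⇒σ∙∼∙σ r∼σrσ
      sσr : SelfInverse (σ ∙ r)
      sσr = ∼-trans σr∼rσ (∼-trans (∙σ-cong s) (≈⇒∼ (sym (σ∙-⁻¹ r))))
      cover : ∀ g → SelfInverseIn r g → r ∼ g ⊎ σ ∙ r ∼ g
      cover g (_ , r∼ᴷg) with ∼ᴷ-cases r∼ᴷg
      ... | inj₁ r∼g                = inj₁ r∼g
      ... | inj₂ (inj₁ σr∼g)        = inj₂ σr∼g
      ... | inj₂ (inj₂ (inj₁ rσ∼g)) = inj₂ (∼-trans σr∼rσ rσ∼g)
      ... | inj₂ (inj₂ (inj₂ σrσ∼g)) = inj₁ (∼-trans r∼σrσ σrσ∼g)

    transversal-r,σrσ : ∀ {r} → SelfInverse r → ¬ r ∼ σ ∙ r ∙ σ → Transversal _∼_ (SelfInverseIn r) 2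
    transversal-r,σrσ {r} s r≁σrσ =
      transversal-pair ∼-sym (s , ≈⇒∼ᴷ ≈-refl) (SelfInverse-σ∙∙σ s , ∼ᴷ-σ∙∙σ r) r≁σrσ cover
      where
      cover : ∀ g → SelfInverseIn r g → r ∼ g ⊎ σ ∙ r ∙ σ ∼ g
      cover g (sg , r∼ᴷg) with ∼ᴷ-cases r∼ᴷg
      ... | inj₁ r∼g                = inj₁ r∼g
      ... | inj₂ (inj₁ σr∼g)        = ⊥-elim (r≁σrσ (σ∙∼∙σ⇒∼σ∙∙σ
                                        (SelfInverse-σ∙⇒σ∙∼∙σ s (SelfInverse-resp-∼ (∼-sym σr∼g) sg))))
      ... | inj₂ (inj₂ (inj₁ rσ∼g)) = ⊥-elim (r≁σrσ (σ∙∼∙σ⇒∼σ∙∙σ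
                                        (SelfInverse-∙σ⇒σ∙∼∙σ s (SelfInverse-resp-∼ (∼-sym rσ∼g) sg))))
      ... | inj₂ (inj₂ (inj₂ σrσ∼g)) = inj₂ σrσ∼g

    transversal-σr,rσ : ∀ {r} → ¬ SelfInverse r → σ ∙ r ∙ σ ∼ r ⁻¹ → Transversal _∼_ (SelfInverseIn r) 2
    transversal-σr,rσ {r} ¬s σrσ∼r⁻¹ =
      transversal-pair ∼-sym (sσr , ∼ᴷ-σ∙ r) (srσ , ∼ᴷ-∙σ r) σr≁rσ cover
      where
      sσr : SelfInverse (σ ∙ r)
      sσr = ∼-trans (≈⇒∼ (sym (∙σ-involutive (σ ∙ r))))
              (∼-trans (∙σ-cong σrσ∼r⁻¹) (≈⇒∼ (sym (σ∙-⁻¹ r))))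
      srσ : SelfInverse (r ∙ σ)
      srσ = ∼-trans (≈⇒∼ (sym (σ∙[σ∙∙σ]≈∙σ r)))
              (∼-trans (σ∙-cong σrσ∼r⁻¹) (≈⇒∼ (sym (∙σ-⁻¹ r))))
      σr≁rσ : ¬ σ ∙ r ∼ r ∙ σ
      σr≁rσ σr∼rσ = ¬s (∼-trans (σ∙∼∙σ⇒∼σ∙∙σ σr∼rσ) σrσ∼r⁻¹)
      cover : ∀ g → SelfInverseIn r g → σ ∙ r ∼ g ⊎ r ∙ σ ∼ g
      cover g (sg , r∼ᴷg) with ∼ᴷ-cases r∼ᴷg
      ... | inj₁ r∼g                = ⊥-elim (¬s (SelfInverse-resp-∼ (∼-sym r∼g) sg))
      ... | inj₂ (inj₁ σr∼g)        = inj₁ σr∼g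
      ... | inj₂ (inj₂ (inj₁ rσ∼g)) = inj₂ rσ∼g
      ... | inj₂ (inj₂ (inj₂ σrσ∼g)) =
        ⊥-elim (¬s (SelfInverse-σ∙∙σ⁻ (SelfInverse-resp-∼ (∼-sym σrσ∼g) sg)))

    two-self-inverse-classes : ∀ {r} → SelfInverseᴷ r → Transversal _∼_ (SelfInverseIn r) 2
    two-self-inverse-classes {r} sᴷ with r ∼? (r ⁻¹) | r ∼? (σ ∙ r ∙ σ)
    ... | yes s | yes r∼σrσ = transversal-r,σr s r∼σrσ
    ... | yes s | no r≁σrσ  = transversal-r,σrσ s r≁σrσ
    ... | no ¬s | _         = [ (λ s → ⊥-elim (¬s s)) , transversal-σr,rσ ¬s ]′ (SelfInverseᴷ-cases sᴷ)

module _ (_≟_ : DecidableEquality A) where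

  delete : A → List A → List A
  delete y = filter (λ z → ¬? (z ≟ y))

  ∈-delete⁺ : ∀ {y z xs} → z ∈ xs → z ≢ y → z ∈ delete y xs
  ∈-delete⁺ = ∈-filter⁺ (λ z → ¬? (z ≟ _))

  ∈-delete⁻ : ∀ {y z xs} → z ∈ delete y xs → z ∈ xs × z ≢ y
  ∈-delete⁻ = ∈-filter⁻ (λ z → ¬? (z ≟ _))

  delete-Unique : ∀ {y xs} → Unique xs → Unique (delete y xs)
  delete-Unique = Unique-filter⁺ (λ z → ¬? (z ≟ _))

  length-delete : ∀ {y xs} → Unique xs → y ∈ xs → length xs ≡ suc (length (delete y xs))
  length-delete {y} {x ∷ xs} (x∉xs ∷ _) y∈ with x ≟ y
  ... | yes refl = cong (suc ∘ length)
                     (≡.sym (filter-all (λ z → ¬? (z ≟ y)) (All.map (λ x≢z z≡x → x≢z (≡.sym z≡x)) x∉xs)))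
  length-delete {y} {x ∷ xs} (_ ∷ u) (here refl) | no x≢y = ⊥-elim (x≢y refl)
  length-delete {y} {x ∷ xs} (_ ∷ u) (there y∈xs) | no x≢y = cong suc (length-delete u y∈xs)

module _ (_≟_ : DecidableEquality A) (f : A → A) (f⁴≗id : ∀ y → f (f (f (f y))) ≡ y) where

  private
    f³ : A → A
    f³ = f ∘ f ∘ f

    f-injective : ∀ {y z} → f y ≡ f z → y ≡ z
    f-injective {y} {z} fy≡fz = ≡.trans (≡.sym (f⁴≗id y)) (≡.trans (cong f³ fy≡fz) (f⁴≗id z))

    f≡⇒≡f³ : ∀ {y z} → f y ≡ z → y ≡ f³ z
    f≡⇒≡f³ {y} fy≡z = ≡.trans (≡.sym (f⁴≗id y)) (cong f³ fy≡z)

    f²≢⇒f≢ : ∀ {y} → f (f y) ≢ y → f y ≢ y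
    f²≢⇒f≢ f²y≢y fy≡y = f²y≢y (≡.trans (cong f fy≡y) fy≡y)

  deleteOrbit : A → List A → List A
  deleteOrbit y = delete _≟_ (f³ y) ∘ delete _≟_ (f (f y)) ∘ delete _≟_ (f y) ∘ delete _≟_ y

  ∈-deleteOrbit⁺ : ∀ {y z xs} → z ∈ xs → z ≢ y → z ≢ f y → z ≢ f (f y) → z ≢ f³ y → z ∈ deleteOrbit y xs
  ∈-deleteOrbit⁺ z∈ z≢y z≢fy z≢f²y z≢f³y =
    ∈-delete⁺ _≟_ (∈-delete⁺ _≟_ (∈-delete⁺ _≟_ (∈-delete⁺ _≟_ z∈ z≢y) z≢fy) z≢f²y) z≢f³y

  ∈-deleteOrbit⁻ : ∀ {y z xs} → z ∈ deleteOrbit y xs →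
                   z ∈ xs × z ≢ y × z ≢ f y × z ≢ f (f y) × z ≢ f³ y
  ∈-deleteOrbit⁻ z∈ =
    let z∈₃ , z≢f³y = ∈-delete⁻ _≟_ z∈
        z∈₂ , z≢f²y = ∈-delete⁻ _≟_ z∈₃
        z∈₁ , z≢fy  = ∈-delete⁻ _≟_ z∈₂
        z∈  , z≢y   = ∈-delete⁻ _≟_ z∈₁
    in z∈ , z≢y , z≢fy , z≢f²y , z≢f³y

  deleteOrbit-Unique : ∀ {y xs} → Unique xs → Unique (deleteOrbit y xs)
  deleteOrbit-Unique = delete-Unique _≟_ ∘ delete-Unique _≟_ ∘ delete-Unique _≟_ ∘ delete-Unique _≟_

  length-deleteOrbit : ∀ {y xs} → Unique xs → (∀ {z} → z ∈ xs → f z ∈ xs) → f (f y) ≢ y → y ∈ xs →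
                       length xs ≡ 4 + length (deleteOrbit y xs)
  length-deleteOrbit {y} u closed f²y≢y y∈ =
    ≡.trans (length-delete _≟_ u y∈)
      (cong suc (≡.trans (length-delete _≟_ u₁ fy∈)
        (cong suc (≡.trans (length-delete _≟_ u₂ f²y∈)
          (cong suc (length-delete _≟_ u₃ f³y∈))))))
    where
    u₁ = delete-Unique _≟_ u
    u₂ = delete-Unique _≟_ u₁
    u₃ = delete-Unique _≟_ u₂
    fy≢y = f²≢⇒f≢ f²y≢y
    f³y≢y : f³ y ≢ y
    f³y≢y f³y≡y = fy≢y (≡.trans (≡.sym (cong f f³y≡y)) (f⁴≗id y))
    fy∈ = ∈-delete⁺ _≟_ (closed y∈) fy≢y
    f²y∈ = ∈-delete⁺ _≟_ (∈-delete⁺ _≟_ (closed (closed y∈)) f²y≢y) (fy≢y ∘ f-injective)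
    f³y∈ = ∈-delete⁺ _≟_ (∈-delete⁺ _≟_ (∈-delete⁺ _≟_ (closed (closed (closed y∈))) f³y≢y)
             (f²y≢y ∘ f-injective)) (fy≢y ∘ f-injective ∘ f-injective)

  4∣length : ∀ {xs} → Unique xs → (∀ {y} → y ∈ xs → f y ∈ xs) → (∀ {y} → y ∈ xs → f (f y) ≢ y) →
             4 ∣ length xs
  4∣length {xs} = go xs (<-wellFounded (length xs))
    where
    go : ∀ xs → Acc _<_ (length xs) → Unique xs → (∀ {y} → y ∈ xs → f y ∈ xs) →
         (∀ {y} → y ∈ xs → f (f y) ≢ y) → 4 ∣ length xs
    go []          _         _ _      _    = divides 0 refl
    go xs@(y ∷ _) (acc rec) u closed free = subst (4 ∣_) (≡.sym length≡) (∣m∣n⇒∣m+n ∣-refl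
      (go rest (rec rest<) (deleteOrbit-Unique u) closed-rest (free ∘ proj₁ ∘ ∈-deleteOrbit⁻)))
      where
      rest = deleteOrbit y xs
      length≡ : length xs ≡ 4 + length rest
      length≡ = length-deleteOrbit u closed (free (here refl)) (here refl)
      rest< : length rest < length xs
      rest< = subst (suc (length rest) ≤_) (≡.sym length≡) (m≤n+m (suc (length rest)) 3)
      closed-rest : ∀ {z} → z ∈ rest → f z ∈ rest
      closed-rest z∈ =
        let z∈xs , z≢y , z≢fy , z≢f²y , z≢f³y = ∈-deleteOrbit⁻ z∈
        in ∈-deleteOrbit⁺ (closed z∈xs)
             (z≢f³y ∘ f≡⇒≡f³) (z≢y ∘ f-injective) (z≢fy ∘ f-injective) (z≢f²y ∘ f-injective)

insert-cong : ∀ {m n} i j {π ρ : Permutation m n} → π ≈ₚ ρ → insert i j π ≈ₚ insert i j ρ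
insert-cong i j eq k with i ≟ k
... | yes _   = refl
... | no i≢k  = cong (punchIn j) (eq (punchOut i≢k))

allPermutations : ∀ n → List (Permutation′ n)
allPermutations zero    = Permutation.id ∷ []
allPermutations (suc n) = cartesianProductWith (insert zero) (allFin (suc n)) (allPermutations n)

allPermutations-complete : ∀ {n} (π : Permutation′ n) → Any (π ≈ₚ_) (allPermutations n)
allPermutations-complete {zero}  π = here λ ()
allPermutations-complete {suc n} π = cartesianProductWith⁺ (insert zero) π≈insert
  (∈-allFin (π ⟨$⟩ʳ zero)) (allPermutations-complete (Permutation.remove zero π))
  where
  π≈insert : ∀ {j ρ} → π ⟨$⟩ʳ zero ≡ j → Permutation.remove zero π ≈ₚ ρ → π ≈ₚ insert zero j ρ
  π≈insert refl π₀≈ρ i = ≡.trans (≡.sym (insert-remove zero π i)) (insert-cong zero _ π₀≈ρ i)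

module _ (n : ℕ) where

  _≈ₚ?_ : Decidable₂ (_≈ₚ_ {n} {n})
  g ≈ₚ? h = all? λ i → g ⟨$⟩ʳ i ≟ h ⟨$⟩ʳ i

  -- g ∙ h is g after h, so that (h₁ ∙ g ∙ h₂) ⟨$⟩ʳ i reduces to h₁ ⟨$⟩ʳ (g ⟨$⟩ʳ (h₂ ⟨$⟩ʳ i))
  -- as in InDC and SelfInverseDC.
  permutationGroup : Group 0ℓ 0ℓ
  permutationGroup = record
    { Carrier = Permutation′ n
    ; _≈_ = _≈ₚ_
    ; _∙_ = λ g h → h Permutation.∘ₚ g
    ; ε = Permutation.id
    ; _⁻¹ = Permutation.flip
    ; isGroup = record
      { isMonoid = record
        { isSemigroup = record
          { isMagma = record
            { isEquivalence = record
              { refl = λ _ → refl ; sym = λ p i → ≡.sym (p i) ; trans = λ p q i → ≡.trans (p i) (q i) }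
            ; ∙-cong = λ {g} {g′} {h} {h′} p q i → ≡.trans (cong (g ⟨$⟩ʳ_) (q i)) (p (h′ ⟨$⟩ʳ i))
            }
          ; assoc = λ _ _ _ _ → refl
          }
        ; identity = (λ _ _ → refl) , (λ _ _ → refl)
        }
      ; inverse = (λ g _ → Permutation.inverseˡ g) , (λ g _ → Permutation.inverseʳ g)
      ; ⁻¹-cong = λ {g} {h} p i →
          ≡.trans (cong (g ⟨$⟩ˡ_) (≡.trans (≡.sym (Permutation.inverseʳ h)) (≡.sym (p (h ⟨$⟩ˡ i)))))
            (Permutation.inverseˡ g)
      }
    }

module Modular (n : ℕ) {{_ : NonZero n}} where

  infix 4 _≋_
  _≋_ : Rel ℕ 0ℓ
  a ≋ b = a % n ≡ b % n

  ≋-setoid : Setoid 0ℓ 0ℓ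
  ≋-setoid = record { isEquivalence = On.isEquivalence (_% n) ≡.isEquivalence }

  open Setoid ≋-setoid public using () renaming (refl to ≋-refl; sym to ≋-sym; trans to ≋-trans)
  open import Relation.Binary.Reasoning.Setoid ≋-setoid

  ≡⇒≋ : ∀ {a b} → a ≡ b → a ≋ b
  ≡⇒≋ = cong (_% n)

  %-≋ : ∀ a → a % n ≋ a
  %-≋ a = m%n%n≡m%n a n

  +n-≋ : ∀ a → a + n ≋ a
  +n-≋ a = [m+n]%n≡m%n a n

  +-cong-≋ : ∀ {a b c d} → a ≋ b → c ≋ d → a + c ≋ b + d
  +-cong-≋ {a} {b} {c} {d} a≋b c≋d = ≡.trans (%-distribˡ-+ a c n)
    (≡.trans (≡.cong₂ (λ x y → (x + y) % n) a≋b c≋d) (≡.sym (%-distribˡ-+ b d n)))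

  +-congˡ-≋ : ∀ a {c d} → c ≋ d → a + c ≋ a + d
  +-congˡ-≋ a = +-cong-≋ (≋-refl {a})

  +-congʳ-≋ : ∀ {a b} c → a ≋ b → a + c ≋ b + c
  +-congʳ-≋ c a≋b = +-cong-≋ a≋b (≋-refl {c})

  *-congʳ-≋ : ∀ {a b} c → a ≋ b → a * c ≋ b * c
  *-congʳ-≋ {a} {b} c a≋b = ≡.trans (%-distribˡ-* a c n)
    (≡.trans (cong (λ x → (x * (c % n)) % n) a≋b) (≡.sym (%-distribˡ-* b c n)))

  -- An additive inverse of a modulo n; the subtraction never truncates since a % n ≤ n.
  neg : ℕ → ℕ
  neg a = n ∸ a % n

  neg-inverseˡ : ∀ a → neg a + a ≋ 0
  neg-inverseˡ a = begin
    neg a + a          ≈⟨ +-congˡ-≋ (neg a) (%-≋ a) ⟨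
    neg a + a % n      ≡⟨ m∸n+n≡m (m%n≤n a n) ⟩
    n                  ≈⟨ +n-≋ 0 ⟩
    0                  ∎

  neg-inverseʳ : ∀ a → a + neg a ≋ 0
  neg-inverseʳ a = ≋-trans (≡⇒≋ (+-comm a (neg a))) (neg-inverseˡ a)

  neg-cancelʳ : ∀ a b → a + neg b + b ≋ a
  neg-cancelʳ a b = begin
    a + neg b + b      ≡⟨ +-assoc a (neg b) b ⟩
    a + (neg b + b)    ≈⟨ +-congˡ-≋ a (neg-inverseˡ b) ⟩
    a + 0              ≡⟨ +-identityʳ a ⟩
    a                  ∎

  +-cancelʳ-≋ : ∀ {a b} c → a + c ≋ b + c → a ≋ b
  +-cancelʳ-≋ {a} {b} c a+c≋b+c = begin
    a                  ≡⟨ +-identityʳ a ⟨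
    a + 0              ≈⟨ +-congˡ-≋ a (neg-inverseʳ c) ⟨
    a + (c + neg c)    ≡⟨ +-assoc a c (neg c) ⟨
    a + c + neg c      ≈⟨ +-congʳ-≋ (neg c) a+c≋b+c ⟩
    b + c + neg c      ≡⟨ +-assoc b c (neg c) ⟩
    b + (c + neg c)    ≈⟨ +-congˡ-≋ b (neg-inverseʳ c) ⟩
    b + 0              ≡⟨ +-identityʳ b ⟩
    b                  ∎

  toℕ-% : ∀ (i : Fin n) → toℕ i % n ≡ toℕ i
  toℕ-% i = m<n⇒m%n≡m (toℕ<n i)

  toℕ-≋-injective : ∀ {i j : Fin n} → toℕ i ≋ toℕ j → i ≡ j
  toℕ-≋-injective {i} {j} i≋j = toℕ-injective (≡.trans (≡.sym (toℕ-% i)) (≡.trans i≋j (toℕ-% j)))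

  toℕ-mod : ∀ a → toℕ (a mod n) ≋ a
  toℕ-mod a = ≡.trans (cong (_% n) (toℕ-fromℕ< (m%n<n a n))) (%-≋ a)

module Polygon (n : ℕ) {{_ : NonZero n}} where

  open Modular n
  open import Relation.Binary.Reasoning.Setoid ≋-setoid
  open Group (permutationGroup n) using (_≈_; _∙_; _⁻¹; ε)

  -- The rotation i ↦ i + k and the reflection i ↦ c - i, stated modulo n without subtraction.
  record IsRotation (k : ℕ) (g : Permutation′ n) : Set where
    constructor isRotation
    field shift : ∀ i → toℕ (g ⟨$⟩ʳ i) ≋ toℕ i + k

  record IsReflection (c : ℕ) (g : Permutation′ n) : Set where
    constructor isReflection
    field sum : ∀ i → toℕ (g ⟨$⟩ʳ i) + toℕ i ≋ c

  IsRotation-resp-≈ : ∀ {k g h} → g ≈ h → IsRotation k g → IsRotation k h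
  IsRotation-resp-≈ {k} g≈h (isRotation shift) =
    isRotation λ i → ≡.subst (λ x → toℕ x ≋ toℕ i + k) (g≈h i) (shift i)

  IsReflection-resp-≈ : ∀ {c g h} → g ≈ h → IsReflection c g → IsReflection c h
  IsReflection-resp-≈ {c} g≈h (isReflection sum) =
    isReflection λ i → ≡.subst (λ x → toℕ x + toℕ i ≋ c) (g≈h i) (sum i)

  IsRotation-unique : ∀ {k k′ g h} → IsRotation k g → IsRotation k′ h → k ≋ k′ → g ≈ h
  IsRotation-unique {k} {k′} {g} {h} (isRotation g-shift) (isRotation h-shift) k≋k′ i =
    toℕ-≋-injective (begin
      toℕ (g ⟨$⟩ʳ i)   ≈⟨ g-shift i ⟩
      toℕ i + k        ≈⟨ +-congˡ-≋ (toℕ i) k≋k′ ⟩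
      toℕ i + k′       ≈⟨ h-shift i ⟨
      toℕ (h ⟨$⟩ʳ i)   ∎)

  IsReflection-unique : ∀ {c c′ g h} → IsReflection c g → IsReflection c′ h → c ≋ c′ → g ≈ h
  IsReflection-unique {c} {c′} {g} {h} (isReflection g-sum) (isReflection h-sum) c≋c′ i =
    toℕ-≋-injective (+-cancelʳ-≋ (toℕ i) (begin
      toℕ (g ⟨$⟩ʳ i) + toℕ i   ≈⟨ g-sum i ⟩
      c                        ≈⟨ c≋c′ ⟩
      c′                       ≈⟨ h-sum i ⟨
      toℕ (h ⟨$⟩ʳ i) + toℕ i   ∎))

  rotation∙rotation : ∀ {a b g h} → IsRotation a g → IsRotation b h → IsRotation (b + a) (g ∙ h)
  rotation∙rotation {a} {b} {g} {h} (isRotation g-shift) (isRotation h-shift) = isRotation λ i → begin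
    toℕ (g ⟨$⟩ʳ (h ⟨$⟩ʳ i))  ≈⟨ g-shift (h ⟨$⟩ʳ i) ⟩
    toℕ (h ⟨$⟩ʳ i) + a       ≈⟨ +-congʳ-≋ a (h-shift i) ⟩
    toℕ i + b + a            ≡⟨ +-assoc (toℕ i) b a ⟩
    toℕ i + (b + a)          ∎

  rotation∙reflection : ∀ {a b g h} → IsRotation a g → IsReflection b h → IsReflection (b + a) (g ∙ h)
  rotation∙reflection {a} {b} {g} {h} (isRotation g-shift) (isReflection h-sum) = isReflection sum
    where
    sum : ∀ i → toℕ (g ⟨$⟩ʳ (h ⟨$⟩ʳ i)) + toℕ i ≋ b + a
    sum i = begin
      toℕ (g ⟨$⟩ʳ y) + toℕ i  ≈⟨ +-congʳ-≋ (toℕ i) (g-shift y) ⟩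
      toℕ y + a + toℕ i       ≡⟨ xy∙z≈xz∙y (toℕ y) a (toℕ i) ⟩
      toℕ y + toℕ i + a       ≈⟨ +-congʳ-≋ a (h-sum i) ⟩
      b + a                   ∎
      where y = h ⟨$⟩ʳ i

  reflection∙rotation : ∀ {a b g h} → IsReflection a g → IsRotation b h →
                        IsReflection (a + neg b) (g ∙ h)
  reflection∙rotation {a} {b} {g} {h} (isReflection g-sum) (isRotation h-shift) = isReflection sum
    where
    sum : ∀ i → toℕ (g ⟨$⟩ʳ (h ⟨$⟩ʳ i)) + toℕ i ≋ a + neg b
    sum i = +-cancelʳ-≋ b (begin
      toℕ (g ⟨$⟩ʳ y) + toℕ i + b     ≡⟨ +-assoc (toℕ (g ⟨$⟩ʳ y)) (toℕ i) b ⟩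
      toℕ (g ⟨$⟩ʳ y) + (toℕ i + b)   ≈⟨ +-congˡ-≋ (toℕ (g ⟨$⟩ʳ y)) (h-shift i) ⟨
      toℕ (g ⟨$⟩ʳ y) + toℕ y         ≈⟨ g-sum y ⟩
      a                              ≈⟨ neg-cancelʳ a b ⟨
      a + neg b + b                  ∎)
      where y = h ⟨$⟩ʳ i

  reflection∙reflection : ∀ {a b g h} → IsReflection a g → IsReflection b h →
                          IsRotation (a + neg b) (g ∙ h)
  reflection∙reflection {a} {b} {g} {h} (isReflection g-sum) (isReflection h-sum) = isRotation shift
    where
    shift : ∀ i → toℕ (g ⟨$⟩ʳ (h ⟨$⟩ʳ i)) ≋ toℕ i + (a + neg b)
    shift i = +-cancelʳ-≋ b (begin
      toℕ (g ⟨$⟩ʳ y) + b                ≈⟨ +-congˡ-≋ (toℕ (g ⟨$⟩ʳ y)) (h-sum i) ⟨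
      toℕ (g ⟨$⟩ʳ y) + (toℕ y + toℕ i)  ≡⟨ +-assoc (toℕ (g ⟨$⟩ʳ y)) (toℕ y) (toℕ i) ⟨
      toℕ (g ⟨$⟩ʳ y) + toℕ y + toℕ i    ≈⟨ +-congʳ-≋ (toℕ i) (g-sum y) ⟩
      a + toℕ i                         ≈⟨ +-congʳ-≋ (toℕ i) (neg-cancelʳ a b) ⟨
      a + neg b + b + toℕ i             ≡⟨ xy∙z≈zx∙y (a + neg b) b (toℕ i) ⟩
      toℕ i + (a + neg b) + b           ∎)
      where y = h ⟨$⟩ʳ i

  rotation⁻¹ : ∀ {a g} → IsRotation a g → IsRotation (neg a) (g ⁻¹)
  rotation⁻¹ {a} {g} (isRotation g-shift) = isRotation shift
    where
    shift : ∀ i → toℕ (g ⟨$⟩ˡ i) ≋ toℕ i + neg a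
    shift i = +-cancelʳ-≋ a (begin
      toℕ y + a                 ≈⟨ g-shift y ⟨
      toℕ (g ⟨$⟩ʳ y)            ≡⟨ cong toℕ (Permutation.inverseʳ g) ⟩
      toℕ i                     ≈⟨ neg-cancelʳ (toℕ i) a ⟨
      toℕ i + neg a + a         ∎)
      where y = g ⟨$⟩ˡ i

  reflection⁻¹ : ∀ {a g} → IsReflection a g → IsReflection a (g ⁻¹)
  reflection⁻¹ {a} {g} (isReflection g-sum) = isReflection sum
    where
    sum : ∀ i → toℕ (g ⟨$⟩ˡ i) + toℕ i ≋ a
    sum i = begin
      toℕ y + toℕ i             ≡⟨ cong (λ x → toℕ y + toℕ x) (Permutation.inverseʳ g) ⟨
      toℕ y + toℕ (g ⟨$⟩ʳ y)    ≡⟨ +-comm (toℕ y) _ ⟩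
      toℕ (g ⟨$⟩ʳ y) + toℕ y    ≈⟨ g-sum y ⟩
      a                         ∎
      where y = g ⟨$⟩ˡ i

  rotate : ℕ → Fin n → Fin n
  rotate k i = (toℕ i + k) mod n

  rotate-rotate : ∀ {a b} → a + b ≋ 0 → ∀ i → rotate b (rotate a i) ≡ i
  rotate-rotate {a} {b} a+b≋0 i = toℕ-≋-injective (begin
    toℕ (rotate b (rotate a i))  ≈⟨ toℕ-mod _ ⟩
    toℕ (rotate a i) + b         ≈⟨ +-congʳ-≋ b (toℕ-mod _) ⟩
    toℕ i + a + b                ≡⟨ +-assoc (toℕ i) a b ⟩
    toℕ i + (a + b)              ≈⟨ +-congˡ-≋ (toℕ i) a+b≋0 ⟩
    toℕ i + 0                    ≡⟨ +-identityʳ (toℕ i) ⟩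
    toℕ i                        ∎)

  rotation : ℕ → Permutation′ n
  rotation k = permutation (rotate k) (rotate (neg k))
    (rotate-rotate (neg-inverseˡ k)) (rotate-rotate (neg-inverseʳ k))

  rotation-IsRotation : ∀ k → IsRotation k (rotation k)
  rotation-IsRotation k = isRotation λ i → toℕ-mod (toℕ i + k)

  reflect : ℕ → Fin n → Fin n
  reflect c i = (c + neg (toℕ i)) mod n

  reflect-reflects : ∀ c i → toℕ (reflect c i) + toℕ i ≋ c
  reflect-reflects c i = ≋-trans (+-congʳ-≋ (toℕ i) (toℕ-mod _)) (neg-cancelʳ c (toℕ i))

  reflect-involutive : ∀ c i → reflect c (reflect c i) ≡ i
  reflect-involutive c i = toℕ-≋-injective (+-cancelʳ-≋ (toℕ j) (begin
    toℕ (reflect c j) + toℕ j   ≈⟨ reflect-reflects c j ⟩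
    c                           ≈⟨ reflect-reflects c i ⟨
    toℕ j + toℕ i               ≡⟨ +-comm (toℕ j) (toℕ i) ⟩
    toℕ i + toℕ j               ∎))
    where j = reflect c i

  reflection : ℕ → Permutation′ n
  reflection c = permutation (reflect c) (reflect c) (reflect-involutive c) (reflect-involutive c)

  reflection-IsReflection : ∀ c → IsReflection c (reflection c)
  reflection-IsReflection c = isReflection (reflect-reflects c)

  InZ⇒IsRotation : ∀ {g} (g∈ : InZ n g) → IsRotation (proj₁ g∈) g
  InZ⇒IsRotation {g} (_ , eq) = isRotation λ i → ≡.trans (toℕ-% (g ⟨$⟩ʳ i)) (eq i)

  IsRotation⇒InZ : ∀ {k g} → IsRotation k g → InZ n g
  IsRotation⇒InZ {k} {g} (isRotation shift) = k , λ i → ≡.trans (≡.sym (toℕ-% (g ⟨$⟩ʳ i))) (shift i)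

  private
    n+-∸-≋ : ∀ c (i : Fin n) → c + n ∸ toℕ i + toℕ i ≋ c
    n+-∸-≋ c i = ≋-trans (≡⇒≋ (m∸n+n≡m (≤-trans (<⇒≤ (toℕ<n i)) (m≤n+m n c)))) (+n-≋ c)

  InD⇒IsRotation⊎IsReflection : ∀ {g} (g∈ : InD n g) →
                                IsRotation (proj₁ g∈) g ⊎ IsReflection (proj₁ g∈) g
  InD⇒IsRotation⊎IsReflection {g} (k , inj₁ eq) = inj₁ (InZ⇒IsRotation {g} (k , eq))
  InD⇒IsRotation⊎IsReflection {g} (k , inj₂ eq) = inj₂ (isReflection λ i →
    ≋-trans (+-congʳ-≋ (toℕ i) (≡.trans (toℕ-% (g ⟨$⟩ʳ i)) (eq i))) (n+-∸-≋ k i))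

  IsRotation⇒InD : ∀ {k g} → IsRotation k g → InD n g
  IsRotation⇒InD {k} {g} g-rot = k , inj₁ (proj₂ (IsRotation⇒InZ {k} {g} g-rot))

  IsReflection⇒InD : ∀ {c g} → IsReflection c g → InD n g
  IsReflection⇒InD {c} {g} (isReflection sum) = c , inj₂ λ i → ≡.trans (≡.sym (toℕ-% (g ⟨$⟩ʳ i)))
    (+-cancelʳ-≋ (toℕ i) (≋-trans (sum i) (≋-sym (n+-∸-≋ c i))))

  ε-IsRotation : IsRotation 0 ε
  ε-IsRotation = isRotation λ i → ≡⇒≋ (≡.sym (+-identityʳ (toℕ i)))

  InZ-isSubgroup : IsSubgroup (permutationGroup n) (InZ n)
  InZ-isSubgroup = record
    { ε∈       = IsRotation⇒InZ ε-IsRotation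
    ; ∙∈       = λ {g} {h} g∈ h∈ → IsRotation⇒InZ
                   (rotation∙rotation (InZ⇒IsRotation {g} g∈) (InZ⇒IsRotation {h} h∈))
    ; ⁻¹∈      = λ {g} g∈ → IsRotation⇒InZ (rotation⁻¹ (InZ⇒IsRotation {g} g∈))
    ; ∈-resp-≈ = λ {g} {h} g≈h g∈ →
                   IsRotation⇒InZ (IsRotation-resp-≈ {h = h} g≈h (InZ⇒IsRotation {g} g∈))
    }

  InD-isSubgroup : IsSubgroup (permutationGroup n) (InD n)
  InD-isSubgroup = record
    { ε∈       = IsRotation⇒InD ε-IsRotation
    ; ∙∈       = λ {g} {h} g∈ h∈ → ∙∈ (InD⇒IsRotation⊎IsReflection {g} g∈)
                                      (InD⇒IsRotation⊎IsReflection {h} h∈)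
    ; ⁻¹∈      = λ {g} g∈ → ⁻¹∈ (InD⇒IsRotation⊎IsReflection {g} g∈)
    ; ∈-resp-≈ = λ {g} {h} g≈h g∈ → resp {h = h} g≈h (InD⇒IsRotation⊎IsReflection {g} g∈)
    }
    where
    ∙∈ : ∀ {a b g h} → IsRotation a g ⊎ IsReflection a g → IsRotation b h ⊎ IsReflection b h →
         InD n (g ∙ h)
    ∙∈ (inj₁ g-rot) (inj₁ h-rot) = IsRotation⇒InD (rotation∙rotation g-rot h-rot)
    ∙∈ (inj₁ g-rot) (inj₂ h-ref) = IsReflection⇒InD (rotation∙reflection g-rot h-ref)
    ∙∈ (inj₂ g-ref) (inj₁ h-rot) = IsReflection⇒InD (reflection∙rotation g-ref h-rot)
    ∙∈ (inj₂ g-ref) (inj₂ h-ref) = IsRotation⇒InD (reflection∙reflection g-ref h-ref)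
    ⁻¹∈ : ∀ {a g} → IsRotation a g ⊎ IsReflection a g → InD n (g ⁻¹)
    ⁻¹∈ (inj₁ g-rot) = IsRotation⇒InD (rotation⁻¹ g-rot)
    ⁻¹∈ (inj₂ g-ref) = IsReflection⇒InD (reflection⁻¹ g-ref)
    resp : ∀ {a g h} → g ≈ h → IsRotation a g ⊎ IsReflection a g → InD n h
    resp {h = h} g≈h (inj₁ g-rot) = IsRotation⇒InD (IsRotation-resp-≈ {h = h} g≈h g-rot)
    resp {h = h} g≈h (inj₂ g-ref) = IsReflection⇒InD (IsReflection-resp-≈ {h = h} g≈h g-ref)

  rotations : Fin n → Permutation′ n
  rotations j = rotation (toℕ j)

  rotations∈ : ∀ j → InZ n (rotations j)
  rotations∈ j = IsRotation⇒InZ (rotation-IsRotation (toℕ j))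

  rotations-complete : ∀ g → InZ n g → Σ (Fin n) λ j → g ≈ rotations j
  rotations-complete g g∈@(k , _) =
    k mod n , IsRotation-unique (InZ⇒IsRotation {g} g∈) (rotation-IsRotation _) (≋-sym (toℕ-mod k))

  symmetry : Fin n ⊎ Fin n → Permutation′ n
  symmetry = [ rotation ∘ toℕ , reflection ∘ toℕ ]′

  symmetries : Fin (n + n) → Permutation′ n
  symmetries = symmetry ∘ splitAt n

  symmetries∈ : ∀ t → InD n (symmetries t)
  symmetries∈ t with splitAt n t
  ... | inj₁ j = IsRotation⇒InD (rotation-IsRotation (toℕ j))
  ... | inj₂ j = IsReflection⇒InD (reflection-IsReflection (toℕ j))

  symmetries-complete : ∀ g → InD n g → Σ (Fin (n + n)) λ t → g ≈ symmetries t
  symmetries-complete g g∈@(k , _) with InD⇒IsRotation⊎IsReflection {g} g∈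
  ... | inj₁ g-rot = k mod n ↑ˡ n , ≡.subst (λ s → g ≈ symmetry s) (≡.sym (splitAt-↑ˡ n (k mod n) n))
    (IsRotation-unique g-rot (rotation-IsRotation _) (≋-sym (toℕ-mod k)))
  ... | inj₂ g-ref = n ↑ʳ k mod n , ≡.subst (λ s → g ≈ symmetry s) (≡.sym (splitAt-↑ʳ n n (k mod n)))
    (IsReflection-unique g-ref (reflection-IsReflection _) (≋-sym (toℕ-mod k)))

  IsReflection-involutive : ∀ {c τ} → IsReflection c τ → τ ∙ τ ≈ ε
  IsReflection-involutive {c} τ-ref =
    IsRotation-unique (reflection∙reflection τ-ref τ-ref) ε-IsRotation (neg-inverseʳ c)

  IsRotation-fixedPoint⇒≈ε : ∀ {k ρ y} → IsRotation k ρ → ρ ⟨$⟩ʳ y ≡ y → ρ ≈ ε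
  IsRotation-fixedPoint⇒≈ε {k} {ρ} {y} ρ-rot@(isRotation shift) ρy≡y =
    IsRotation-unique ρ-rot ε-IsRotation (+-cancelʳ-≋ (toℕ y) (begin
      k + toℕ y        ≡⟨ +-comm k (toℕ y) ⟩
      toℕ y + k        ≈⟨ shift y ⟨
      toℕ (ρ ⟨$⟩ʳ y)   ≡⟨ cong toℕ ρy≡y ⟩
      toℕ y            ∎))

  IsReflection-≉ε : ∀ {c τ} → 2 < n → IsReflection c τ → ¬ τ ≈ ε
  IsReflection-≉ε {c} {τ} 2<n (isReflection sum) τ≈ε = 2≢0 (≡.trans (≡.sym (m<n⇒m%n≡m 2<n))
    (≡.trans (≋-trans (sum-at 1<n) (≋-sym (sum-at 0<n))) (m<n⇒m%n≡m 0<n)))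
    where
    1<n = <-trans (s≤s (s≤s z≤n)) 2<n
    0<n = <-trans (s≤s z≤n) 1<n
    sum-at : ∀ {a} → a < n → a + a ≋ c
    sum-at {a} a<n = begin
      a + a                             ≡⟨ ≡.cong₂ _+_ toℕ-i toℕ-i ⟨
      toℕ i + toℕ i                     ≡⟨ cong (λ j → toℕ j + toℕ i) (τ≈ε i) ⟨
      toℕ (τ ⟨$⟩ʳ i) + toℕ i            ≈⟨ sum i ⟩
      c                                 ∎
      where
      i = fromℕ< a<n
      toℕ-i = toℕ-fromℕ< a<n
    2≢0 : 2 ≢ 0
    2≢0 ()

  σ : Permutation′ n
  σ = reflection 0

  σ-IsReflection : IsReflection 0 σ
  σ-IsReflection = reflection-IsReflection 0

  σ∈InD : InD n σ
  σ∈InD = IsReflection⇒InD σ-IsReflection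

  InZ⊆InD : ∀ {h} → InZ n h → InD n h
  InZ⊆InD {h} h∈ = IsRotation⇒InD (InZ⇒IsRotation {h} h∈)

  InD⊆InZ∪σInZ : ∀ {k} → InD n k → InZ n k ⊎ InZ n (σ ∙ k)
  InD⊆InZ∪σInZ {k} k∈ with InD⇒IsRotation⊎IsReflection {k} k∈
  ... | inj₁ k-rot = inj₁ (IsRotation⇒InZ k-rot)
  ... | inj₂ k-ref = inj₂ (IsRotation⇒InZ (reflection∙reflection σ-IsReflection k-ref))

  σ-isIndexTwoExtension : IsIndexTwoExtension (permutationGroup n) (InZ n) (InD n) σ
  σ-isIndexTwoExtension = record
    { σ∈K          = σ∈InD
    ; σ²≈ε         = IsReflection-involutive σ-IsReflection
    ; H⊆K          = λ {h} → InZ⊆InD {h}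
    ; K⊆H∪σH       = λ {k} → InD⊆InZ∪σInZ {k}
    ; σ-normalises = λ {h} → σ-normalises-InZ {h}
    }
    where
    σ-normalises-InZ : ∀ {h} → InZ n h → InZ n (σ ∙ h ∙ σ)
    σ-normalises-InZ {h} h∈ = IsRotation⇒InZ (reflection∙reflection
      (reflection∙rotation σ-IsReflection (InZ⇒IsRotation {h} h∈)) σ-IsReflection)

module OddPolygon (n k : ℕ) {{_ : NonZero n}} (n≡1+2k : n ≡ 1 + 2 * k) where

  open Modular n
  open Polygon n
  open Group (permutationGroup n) using (_≈_; _∙_; _⁻¹; ε)
  open import Relation.Binary.Reasoning.Setoid ≋-setoid

  double-half : ∀ a → (a + a) * suc k ≋ a
  double-half a = begin
    (a + a) * suc k      ≡⟨ ring a k ⟩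
    a + a * (1 + 2 * k)  ≡⟨ cong (λ m → a + a * m) n≡1+2k ⟨
    a + a * n            ≈⟨ [m+kn]%n≡m%n a a n ⟩
    a                    ∎
    where
    ring : ∀ a k → (a + a) * suc k ≡ a + a * (1 + 2 * k)
    ring = solve-∀

  halve : ∀ {a b} → a + a ≋ b + b → a ≋ b
  halve {a} {b} 2a≋2b = begin
    a                  ≈⟨ double-half a ⟨
    (a + a) * suc k    ≈⟨ *-congʳ-≋ (suc k) 2a≋2b ⟩
    (b + b) * suc k    ≈⟨ double-half b ⟩
    b                  ∎

  -- centre c is c / 2 modulo n (suc k inverts 2), the fixed point of the reflection i ↦ c - i.
  centre : ℕ → Fin n
  centre c = (c * suc k) mod n

  centre-double : ∀ c → toℕ (centre c) + toℕ (centre c) ≋ c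
  centre-double c = begin
    toℕ (centre c) + toℕ (centre c)  ≈⟨ +-cong-≋ (toℕ-mod (c * suc k)) (toℕ-mod (c * suc k)) ⟩
    c * suc k + c * suc k            ≡⟨ *-distribʳ-+ (suc k) c c ⟨
    (c + c) * suc k                  ≈⟨ double-half c ⟩
    c                                ∎

  IsReflection-fixes-centre : ∀ {c τ} → IsReflection c τ → τ ⟨$⟩ʳ centre c ≡ centre c
  IsReflection-fixes-centre {c} (isReflection sum) =
    toℕ-≋-injective (+-cancelʳ-≋ (toℕ (centre c)) (≋-trans (sum (centre c)) (≋-sym (centre-double c))))

  IsReflection-fixedPoint-unique : ∀ {c τ y} → IsReflection c τ → τ ⟨$⟩ʳ y ≡ y → y ≡ centre c
  IsReflection-fixedPoint-unique {c} {τ} {y} (isReflection sum) τy≡y = toℕ-≋-injective (halve (begin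
    toℕ y + toℕ y                    ≡⟨ cong (λ z → toℕ z + toℕ y) τy≡y ⟨
    toℕ (τ ⟨$⟩ʳ y) + toℕ y           ≈⟨ sum y ⟩
    c                                ≈⟨ centre-double c ⟨
    toℕ (centre c) + toℕ (centre c)  ∎))

  IsReflection-not-conjugate-IsRotation : ∀ {a c τ ρ} g → 2 < n → IsReflection c τ → IsRotation a ρ →
                                          ¬ τ ≈ g ∙ ρ ∙ g ⁻¹
  IsReflection-not-conjugate-IsRotation {c = c} {τ} {ρ} g 2<n τ-ref ρ-rot τ≈gρg⁻¹ =
    IsReflection-≉ε 2<n τ-ref τ≈ε
    where
    q = g ⟨$⟩ˡ centre c
    ρq≡q : ρ ⟨$⟩ʳ q ≡ q
    ρq≡q = ≡.trans (≡.sym (Permutation.inverseˡ g))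
      (cong (g ⟨$⟩ˡ_) (≡.trans (≡.sym (τ≈gρg⁻¹ (centre c))) (IsReflection-fixes-centre τ-ref)))
    τ≈ε : τ ≈ ε
    τ≈ε i = ≡.trans (τ≈gρg⁻¹ i) (≡.trans
      (cong (g ⟨$⟩ʳ_) (IsRotation-fixedPoint⇒≈ε ρ-rot ρq≡q (g ⟨$⟩ˡ i))) (Permutation.inverseʳ g))

  IsReflection-square-root⇒4∣n∸1 : ∀ {c τ} x → IsReflection c τ → x ∙ x ≈ τ → 4 ∣ n ∸ 1
  IsReflection-square-root⇒4∣n∸1 {c} {τ} x τ-ref x²≈τ =
    subst (4 ∣_) length-others (4∣length _≟_ f f⁴≗id (delete-Unique _≟_ (allFin⁺ n)) closed free)
    where
    f = x ⟨$⟩ʳ_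
    p = centre c
    others = delete _≟_ p (allFin n)
    f⁴≗id : ∀ y → f (f (f (f y))) ≡ y
    f⁴≗id y = ≡.trans (x²≈τ (f (f y)))
      (≡.trans (cong (τ ⟨$⟩ʳ_) (x²≈τ y)) (IsReflection-involutive τ-ref y))
    fp≡p : f p ≡ p
    fp≡p = IsReflection-fixedPoint-unique τ-ref
      (≡.trans (≡.sym (x²≈τ (f p))) (cong f (≡.trans (x²≈τ p) (IsReflection-fixes-centre τ-ref))))
    length-others : length others ≡ n ∸ 1
    length-others = cong (_∸ 1)
      (≡.trans (≡.sym (length-delete _≟_ (allFin⁺ n) (∈-allFin p))) (length-tabulate {n = n} (λ i → i)))
    ≢p : ∀ {y} → y ∈ others → y ≢ p
    ≢p y∈ = proj₂ (∈-delete⁻ _≟_ {xs = allFin n} y∈)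
    closed : ∀ {y} → y ∈ others → f y ∈ others
    closed y∈ = ∈-delete⁺ _≟_ (∈-allFin _) λ fy≡p →
      ≢p y∈ (Injection.injective (↔⇒↣ x) (≡.trans fy≡p (≡.sym fp≡p)))
    free : ∀ {y} → y ∈ others → f (f y) ≢ y
    free y∈ f²y≡y = ≢p y∈ (IsReflection-fixedPoint-unique τ-ref (≡.trans (≡.sym (x²≈τ _)) f²y≡y))

module ThreeModFour (m : ℕ) where

  n : ℕ
  n = 3 + 4 * m

  n≡1+2[1+2m] : n ≡ 1 + 2 * (1 + 2 * m)
  n≡1+2[1+2m] = ring m
    where
    ring : ∀ m → 3 + 4 * m ≡ 1 + 2 * (1 + 2 * m)
    ring = solve-∀

  open Polygon n
  open OddPolygon n (1 + 2 * m) n≡1+2[1+2m]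
  open Group (permutationGroup n) using (_≈_; _∙_; _⁻¹)
  module Z = DoubleCoset (permutationGroup n) InZ-isSubgroup
  module D = DoubleCoset (permutationGroup n) InD-isSubgroup
  open IndexTwo (permutationGroup n) InZ-isSubgroup InD-isSubgroup σ-isIndexTwoExtension

  Zσ-not-conjugate : ∀ h h′ g → InZ n h → InZ n h′ → ¬ (h ∙ σ ≈ g ∙ h′ ∙ g ⁻¹)
  Zσ-not-conjugate h h′ g h∈ h′∈ = IsReflection-not-conjugate-IsRotation g (s≤s (s≤s (s≤s z≤n)))
    (rotation∙reflection (InZ⇒IsRotation {h} h∈) σ-IsReflection) (InZ⇒IsRotation {h′} h′∈)

  Zσ-not-square : ∀ h x → InZ n h → ¬ (x ∙ x ≈ h ∙ σ)
  Zσ-not-square h x h∈ x²≈hσ = 4∤2+4m (IsReflection-square-root⇒4∣n∸1 x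
    (rotation∙reflection (InZ⇒IsRotation {h} h∈) σ-IsReflection) x²≈hσ)
    where
    4∤2+4m : ¬ 4 ∣ 2 + 4 * m
    4∤2+4m 4∣2+4m with ∣⇒≤ (∣m+n∣m⇒∣n (subst (4 ∣_) (+-comm 2 (4 * m)) 4∣2+4m) (m∣m*n m))
    ... | s≤s (s≤s ())

  D-decSetoid : DecSetoid 0ℓ 0ℓ
  D-decSetoid = D.∼-decSetoid (_≈ₚ?_ n) symmetries symmetries∈ symmetries-complete

  D-transversal : Σ ℕ (ThetaCard (InD n))
  D-transversal = transversal-exists D-decSetoid (λ g → DecSetoid._≟_ D-decSetoid g (g ⁻¹))
    (λ {g} {g′} → D.SelfInverse-resp-∼ {g} {g′}) (allPermutations n)
    (λ g → Any.map (λ {h} → D.≈⇒∼ {g} {h}) (allPermutations-complete g))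

  self-inverse-Z-classes : ∀ {r} → D.SelfInverse r → Transversal Z._∼_ (SelfInverseIn r) 2
  self-inverse-Z-classes {r} = two-self-inverse-classes Zσ-not-conjugate Zσ-not-square
    (Z._∼?_ (_≈ₚ?_ n) rotations rotations∈ rotations-complete) {r}

  Z-transversal : ∀ {b} → ThetaCard (InD n) b → ThetaCard (InZ n) (2 * b)
  Z-transversal Θᴰ = transversal-fibred {_≈_ = D._∼_} {Z._∼_} {D.SelfInverse} {Z.SelfInverse}
    D.∼-isEquivalence (λ {g} {g′} → ∼⇒∼ᴷ {g} {g′}) (λ {g} → ∼⇒∼ᴷ {g} {g ⁻¹}) Θᴰ
    (λ {r} → self-inverse-Z-classes {r})

proposition5 : (m : ℕ) →
    Σ ℕ λ a → Σ ℕ λ b →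
      ThetaCard (InZ (3 + 4 * m)) a × ThetaCard (InD (3 + 4 * m)) b × a ≡ 2 * b
proposition5 m = 2 * b , b , Z-transversal Θᴰ , Θᴰ , refl
  where
  open ThreeModFour m
  b = proj₁ D-transversal
  Θᴰ = proj₂ D-transversal
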